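{- For every graph $G$, $\chi(G)\le Z(G)+1$, where $\chi(G)$ is the chromatic number of $G$.
   Context: All graphs are finite, simple and undirected. Zero forcing: vertices are coloured black or white; if a black vertex $u$ has exactly one white neighbour $v$, then $v$ is recoloured black. A set $Z\subseteq V(G)$ is a zero forcing set if, starting with $Z$ black and all other vertices white, repeated application of this rule colours all vertices black; $Z(G)$ is the minimum size of a zero forcing set. -}

module Defs where

open import Data.Nat using (ℕ; _≤_)
open import Data.Fin using (Fin)
open import Data.Fin.Subset using (Subset; _∈_; _∉_; ∣_∣)
open import Data.Product using (Σ; _×_; ∃)
open import Relation.Binary.PropositionalEquality using (_≡_)
open import Relation.Nullary using (¬_)

record Graph (n : ℕ) : Set₁ where
  field
    Adj   : Fin n → Fin n → Set
    irrefl : ∀ {u} → ¬ Adj u u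
    sym    : ∀ {u v} → Adj u v → Adj v u
open Graph public

ProperColouring : ∀ {n} → Graph n → (k : ℕ) → (Fin n → Fin k) → Set
ProperColouring G k c = ∀ {u v} → Adj G u v → ¬ (c u ≡ c v)

Colourable : ∀ {n} → Graph n → ℕ → Set
Colourable {n} G k = Σ (Fin n → Fin k) (ProperColouring G k)

IsChromaticNumber : ∀ {n} → Graph n → ℕ → Set
IsChromaticNumber G χ = Colourable G χ × (∀ k → Colourable G k → χ ≤ k)

-- Vertices that end up black when starting from Z (closure under the
-- zero forcing rule): v is black if v ∈ Z, or some black u adjacent to v
-- has all its neighbours other than v black (so v is u's unique white
-- neighbour, and u forces v).
data Black {n} (G : Graph n) (Z : Subset n) : Fin n → Set where
  initial : ∀ {v} → v ∈ Z → Black G Z v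
  force   : ∀ {u v} → Black G Z u → Adj G u v →
            (∀ w → Adj G u w → ¬ (w ≡ v) → Black G Z w) →
            Black G Z v

IsZeroForcingSet : ∀ {n} → Graph n → Subset n → Set
IsZeroForcingSet {n} G Z = ∀ (v : Fin n) → Black G Z v

IsZeroForcingNumber : ∀ {n} → Graph n → ℕ → Set
IsZeroForcingNumber {n} G z =
  Σ (Subset n) (λ Z → IsZeroForcingSet G Z × ∣ Z ∣ ≡ z)
  × (∀ (Z : Subset n) → IsZeroForcingSet G Z → z ≤ ∣ Z ∣)

module Submission where

-- Induction on the number of vertices, carrying a zero forcing
-- set Z together with m "slots" s : Fin m → V covering Z; we build a proper
-- colouring with m + 1 colours.  If some v ∈ Z can force at the very start
-- (all neighbours of v except one vertex x lie in Z), delete v: moving the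
-- slots sitting on v to x, the slots cover (Z − v) ∪ {x}, which is a zero
-- forcing set of G − v containing every neighbour of v.  Colour G − v by
-- induction; the m slots use at most m colours, so some colour is free for v.
-- If no vertex of Z can force, nothing outside Z ever becomes black, so Z
-- contains every vertex and colouring each vertex by its slot is proper.
-- Adjacency is an arbitrary type, so the argument lives in the double-negation
-- monad (to decide whether an initial force exists); the final inequality on ℕ
-- is decidable, hence stable, which removes the double negation.

open import Defs hiding (sym)
open import Data.Nat using (ℕ; suc; zero; _≤_; _+_; _≤?_)
open import Data.Nat.Properties using (+-comm; 1+n≰n)
open import Data.Fin using (Fin; zero; suc; punchIn; punchOut; inject₁)
open import Data.Fin.Properties
  using (_≟_; any?; all?; injective⇒≤; punchIn-injective; punchInᵢ≢i; punchIn-punchOut; inject₁-injective)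
open import Data.Fin.Subset using (Subset; _∈_; ⁅_⁆; _∪_; ∣_∣; inside; outside)
  renaming (⊥ to ∅)
open import Data.Fin.Subset.Properties using (x∈⁅x⁆; x∈⁅y⁆⇒x≡y; x∈p∪q⁺; x∈p∪q⁻; ∉⊥)
open import Data.Vec using ([]; _∷_; here; there)
open import Data.Vec.Functional using (insertAt) renaming (_∷_ to _◂_)
open import Data.Vec.Functional.Properties using (insertAt-lookup; insertAt-punchIn)
open import Data.Product using (Σ; ∃; ∃₂; _×_; _,_; proj₁; proj₂)
open import Data.Sum using (_⊎_; inj₁; inj₂)
open import Data.Empty using (⊥-elim)
open import Function using (_∘_)
open import Function.Definitions using (Injective)
open import Relation.Nullary using (¬_; yes; no; ¬?; contradiction)
open import Relation.Nullary.Decidable using (decidable-stable; ¬¬-excluded-middle)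
open import Relation.Binary.PropositionalEquality
  using (_≡_; _≢_; refl; sym; trans; cong; subst)

Covers : ∀ {m n} → (Fin m → Fin n) → Subset n → Set
Covers s Z = ∀ {w} → w ∈ Z → ∃ λ i → s i ≡ w

image : ∀ {m n} → (Fin m → Fin n) → Subset n
image {zero}  s = ∅
image {suc m} s = ⁅ s zero ⁆ ∪ image (s ∘ suc)

∈-image : ∀ {m n} (s : Fin m → Fin n) i → s i ∈ image s
∈-image s zero    = x∈p∪q⁺ (inj₁ (x∈⁅x⁆ (s zero)))
∈-image s (suc i) = x∈p∪q⁺ (inj₂ (∈-image (s ∘ suc) i))

image-covered : ∀ {m n} (s : Fin m → Fin n) → Covers s (image s)
image-covered {zero}  s w∈∅ = ⊥-elim (∉⊥ w∈∅)
image-covered {suc m} s w∈ with x∈p∪q⁻ ⁅ s zero ⁆ (image (s ∘ suc)) w∈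
... | inj₁ w∈⁅s₀⁆ = zero , sym (x∈⁅y⁆⇒x≡y (s zero) w∈⁅s₀⁆)
... | inj₂ w∈rest with image-covered (s ∘ suc) w∈rest
...   | i , sᵢ≡w = suc i , sᵢ≡w

enumerate : ∀ {n} (Z : Subset n) → Σ (Fin ∣ Z ∣ → Fin n) λ s → Covers s Z
enumerate [] = (λ ()) , λ ()
enumerate (inside ∷ Z) with enumerate Z
... | s , cov = (zero ◂ (suc ∘ s)) , covers
  where
  covers : Covers (zero ◂ (suc ∘ s)) (inside ∷ Z)
  covers here        = zero , refl
  covers (there w∈Z) with cov w∈Z
  ... | i , sᵢ≡w = suc i , cong suc sᵢ≡w
enumerate (outside ∷ Z) with enumerate Z
... | s , cov = suc ∘ s , covers
  where
  covers : Covers (suc ∘ s) (outside ∷ Z)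
  covers (there w∈Z) with cov w∈Z
  ... | i , sᵢ≡w = i , cong suc sᵢ≡w

-- Pigeonhole: m slots cannot use up all of suc m colours, since choosing a
-- slot for every colour would inject Fin (suc m) into Fin m.
freeColour : ∀ {m} (f : Fin m → Fin (suc m)) → ∃ λ k → ∀ i → f i ≢ k
freeColour {m} f with any? (λ k → all? (λ i → ¬? (f i ≟ k)))
... | yes free    = free
... | no allUsed = contradiction (injective⇒≤ preimage-injective) 1+n≰n
  where
  preimage : ∀ k → ∃ λ i → f i ≡ k
  preimage k with any? (λ i → f i ≟ k)
  ... | yes hit  = hit
  ... | no miss = ⊥-elim (allUsed (k , λ i fᵢ≡k → miss (i , fᵢ≡k)))

  preimage-injective : Injective _≡_ _≡_ (proj₁ ∘ preimage)
  preimage-injective {k} {l} same =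
    trans (sym (proj₂ (preimage k))) (trans (cong f same) (proj₂ (preimage l)))

slotColouring : ∀ {n m} (G : Graph n) (s : Fin m → Fin n) →
  (∀ w → ∃ λ i → s i ≡ w) → Colourable G (suc m)
slotColouring {n} {m} G s cov = colour , proper
  where
  colour : Fin n → Fin (suc m)
  colour w = inject₁ (proj₁ (cov w))

  proper : ProperColouring G (suc m) colour
  proper {a} {b} adj same = irrefl G (subst (Adj G a) (sym a≡b) adj)
    where
    a≡b : a ≡ b
    a≡b = trans (sym (proj₂ (cov a)))
                (trans (cong s (inject₁-injective same)) (proj₂ (cov b)))

_─_ : ∀ {n} → Graph (suc n) → Fin (suc n) → Graph n
G ─ v = record
  { Adj    = λ a b → Adj G (punchIn v a) (punchIn v b)
  ; irrefl = irrefl G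
  ; sym    = Graph.sym G
  }

data DeletionView {n} (v : Fin (suc n)) : Fin (suc n) → Set where
  deleted : DeletionView v v
  kept    : ∀ u → DeletionView v (punchIn v u)

deletionView : ∀ {n} (v u : Fin (suc n)) → DeletionView v u
deletionView v u with u ≟ v
... | yes refl = deleted
... | no u≢v   = subst (DeletionView v) (punchIn-punchOut (u≢v ∘ sym)) (kept _)

extendColouring : ∀ {n k} (G : Graph (suc n)) (v : Fin (suc n))
  (c : Fin n → Fin k) (k₀ : Fin k) → ProperColouring (G ─ v) k c →
  (∀ w → Adj G v (punchIn v w) → c w ≢ k₀) →
  ProperColouring G k (insertAt c v k₀)
extendColouring G v c k₀ proper avoid {a} {b} adj
  with deletionView v a | deletionView v b
... | deleted | deleted = λ _ → irrefl G adj
... | deleted | kept w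
  rewrite insertAt-lookup c v k₀ | insertAt-punchIn c v k₀ w =
    avoid w adj ∘ sym
... | kept w  | deleted
  rewrite insertAt-lookup c v k₀ | insertAt-punchIn c v k₀ w =
    avoid w (Graph.sym G adj)
... | kept a′ | kept b′
  rewrite insertAt-punchIn c v k₀ a′ | insertAt-punchIn c v k₀ b′ =
    proper adj

extendBySlots : ∀ {n m} (G : Graph (suc n)) (v : Fin (suc n)) (s : Fin m → Fin n) →
  (∀ w → Adj G v (punchIn v w) → ∃ λ i → s i ≡ w) →
  Colourable (G ─ v) (suc m) → Colourable G (suc m)
extendBySlots {m = m} G v s nbrs (c , proper) =
  insertAt c v k₀ , extendColouring G v c k₀ proper avoid
  where
  k₀ : Fin (suc m)
  k₀ = proj₁ (freeColour (c ∘ s))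

  avoid : ∀ w → Adj G v (punchIn v w) → c w ≢ k₀
  avoid w adj with nbrs w adj
  ... | i , refl = proj₂ (freeColour (c ∘ s)) i

-- Forces performed by v are replaced by the
-- initial membership of the forced neighbour in Z′.
blackAfterDeletion : ∀ {n} (G : Graph (suc n)) (v : Fin (suc n))
  {Z : Subset (suc n)} {Z′ : Subset n} →
  (∀ w → punchIn v w ∈ Z → w ∈ Z′) →
  (∀ w → Adj G v (punchIn v w) → w ∈ Z′) →
  ∀ {u} → Black G Z u → ∀ w → punchIn v w ≡ u → Black (G ─ v) Z′ w
blackAfterDeletion G v {Z} {Z′} fromZ fromNbr = black
  where
  black : ∀ {u} → Black G Z u → ∀ w → punchIn v w ≡ u → Black (G ─ v) Z′ w
  black (initial u∈Z) w refl = initial (fromZ w u∈Z)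
  black (force {forcer} forcerBlack adj others) w refl
    with deletionView v forcer
  ... | deleted = initial (fromNbr w adj)
  ... | kept f  = force (black forcerBlack f refl) adj λ w′ adj′ w′≢w →
          black (others (punchIn v w′) adj′ (w′≢w ∘ punchIn-injective v w′ w)) w′ refl

InitialForce : ∀ {n} → Graph n → Subset n → Fin n → Fin n → Set
InitialForce G Z v x = v ∈ Z × Adj G v x × (∀ w → Adj G v w → w ≢ x → w ∈ Z)

stalled : ∀ {n} {G : Graph n} {Z : Subset n} → ¬ ∃₂ (InitialForce G Z) →
  ∀ {w} → Black G Z w → w ∈ Z
stalled none (initial w∈Z) = w∈Z
stalled none (force {u} {w} uBlack adj others) =
  ⊥-elim (none (u , w , stalled none uBlack , adj ,
                λ w′ adj′ w′≢w → stalled none (others w′ adj′ w′≢w)))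

module Deletion {n m} (G : Graph (suc n)) {Z : Subset (suc n)} {v x : Fin (suc n)}
  (init : InitialForce G Z v x) (s : Fin m → Fin (suc n)) (cov : Covers s Z) where

  v∈Z : v ∈ Z
  v∈Z = proj₁ init

  v~x : Adj G v x
  v~x = proj₁ (proj₂ init)

  nbrs⊆Z∪x : ∀ w → Adj G v w → w ≢ x → w ∈ Z
  nbrs⊆Z∪x = proj₂ (proj₂ init)

  v≢x : v ≢ x
  v≢x v≡x = irrefl G (subst (Adj G v) (sym v≡x) v~x)

  relocate : Fin (suc n) → Fin n
  relocate u with u ≟ v
  ... | yes _  = punchOut v≢x
  ... | no u≢v = punchOut (u≢v ∘ sym)

  relocate-kept : ∀ u → u ≢ v → punchIn v (relocate u) ≡ u
  relocate-kept u u≢v with u ≟ v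
  ... | yes u≡v = contradiction u≡v u≢v
  ... | no _    = punchIn-punchOut _

  relocate-moved : punchIn v (relocate v) ≡ x
  relocate-moved with v ≟ v
  ... | yes _   = punchIn-punchOut v≢x
  ... | no v≢v = contradiction refl v≢v

  slots : Fin m → Fin n
  slots = relocate ∘ s

  slots-cover : ∀ w → punchIn v w ≡ x ⊎ punchIn v w ∈ Z → ∃ λ i → slots i ≡ w
  slots-cover w (inj₁ w≡x) with cov v∈Z
  ... | i , sᵢ≡v = i , punchIn-injective v _ w
        (trans (cong (punchIn v ∘ relocate) sᵢ≡v) (trans relocate-moved (sym w≡x)))
  slots-cover w (inj₂ w∈Z) with cov w∈Z
  ... | i , sᵢ≡w = i , punchIn-injective v _ w
        (trans (relocate-kept (s i) (punchInᵢ≢i v w ∘ trans (sym sᵢ≡w))) sᵢ≡w)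

  nbrs-covered : ∀ w → Adj G v (punchIn v w) → ∃ λ i → slots i ≡ w
  nbrs-covered w adj with punchIn v w ≟ x
  ... | yes w≡x = slots-cover w (inj₁ w≡x)
  ... | no w≢x  = slots-cover w (inj₂ (nbrs⊆Z∪x (punchIn v w) adj w≢x))

  zeroForcing : IsZeroForcingSet G Z → IsZeroForcingSet (G ─ v) (image slots)
  zeroForcing zfs w = blackAfterDeletion G v fromZ fromNbr (zfs (punchIn v w)) w refl
    where
    occupied : ∀ {w} → ∃ (λ i → slots i ≡ w) → w ∈ image slots
    occupied (i , slotᵢ≡w) = subst (_∈ image slots) slotᵢ≡w (∈-image slots i)

    fromZ : ∀ w → punchIn v w ∈ Z → w ∈ image slots
    fromZ w w∈Z = occupied (slots-cover w (inj₂ w∈Z))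

    fromNbr : ∀ w → Adj G v (punchIn v w) → w ∈ image slots
    fromNbr w adj = occupied (nbrs-covered w adj)

colouring : ∀ {n m} (G : Graph n) (Z : Subset n) (s : Fin m → Fin n) →
  IsZeroForcingSet G Z → Covers s Z → ¬ ¬ Colourable G (suc m)
colouring {zero}  G Z s zfs cov done = done (slotColouring G s λ ())
colouring {suc n} G Z s zfs cov done =
  ¬¬-excluded-middle {A = ∃₂ (InitialForce G Z)} λ where
    (no none) → done (slotColouring G s λ w → cov (stalled none (zfs w)))
    (yes (v , x , init)) →
      let open Deletion G init s cov in
      colouring (G ─ v) (image slots) slots (zeroForcing zfs) (image-covered slots)
        (done ∘ extendBySlots G v slots nbrs-covered)

corollary4p31 : ∀ {n} (G : Graph n) (χ z : ℕ) →
    IsChromaticNumber G χ → IsZeroForcingNumber G z → χ ≤ z + 1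
corollary4p31 {n} G χ z (_ , minimal) ((Z , zfs , ∣Z∣≡z) , _) =
  decidable-stable (χ ≤? z + 1) λ χ≰z+1 →
    colouring G Z s zfs cov λ col → χ≰z+1 (minimal (z + 1) (subst (Colourable G) k≡z+1 col))
  where
  s : Fin ∣ Z ∣ → Fin n
  s = proj₁ (enumerate Z)

  cov : Covers s Z
  cov = proj₂ (enumerate Z)

  k≡z+1 : suc ∣ Z ∣ ≡ z + 1
  k≡z+1 = trans (cong suc ∣Z∣≡z) (+-comm 1 z)
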